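{- Let $a=(a_1,\dots,a_n)$ be a sequence of nonnegative integers. There is a bijection between the set of two-diagonal Tesler matrices associated to $a$ and the set of Young diagrams (partitions) $\mu$ contained in $\lambda(a_2,\dots,a_n)=(a_2+\cdots+a_n,\,a_3+\cdots+a_n,\,\dots,\,a_n)$.
   Context: A Tesler matrix associated to $a=(a_1,\dots,a_n)$ is an upper-triangular $n\times n$ matrix $M=(m_{ij})_{1\leqslant i\leqslant j\leqslant n}$ with nonnegative integer entries satisfying $m_{ii}+\sum_{j<i}m_{ji}-\sum_{j>i}m_{ij}=a_i$ for $1\leqslant i\leqslant n$. It is two-diagonal if $m_{ij}=0$ whenever $j>i+1$. A partition $\mu$ is contained in $\lambda$ if $\mu_k\leqslant\lambda_k$ for all $k$. -}

module Defs where

open import Data.Nat using (ℕ; _+_; _≤_; _<_; _≥_; _<ᵇ_)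
open import Data.Bool using (if_then_else_)
open import Data.Fin using (Fin; toℕ)
open import Data.Vec using (Vec; lookup; tabulate; sum; []; _∷_)
open import Data.List using (List; []; _∷_)
open import Data.List.Relation.Unary.All using (All)
open import Data.List.Relation.Unary.Linked using (Linked)
open import Data.Product using (Σ; _×_; proj₁)
open import Data.Unit using (⊤)
open import Relation.Binary.PropositionalEquality using (_≡_; setoid)
open import Relation.Binary.Bundles using (Setoid)
import Relation.Binary.Construct.On as On

Matrix : ℕ → Set
Matrix n = Vec (Vec ℕ n) n

entry : ∀ {n} → Matrix n → Fin n → Fin n → ℕ
entry M i j = lookup (lookup M i) j

UpperTriangular : ∀ {n} → Matrix n → Set
UpperTriangular {n} M = (i j : Fin n) → toℕ j < toℕ i → entry M i j ≡ 0

colAbove : ∀ {n} → Matrix n → Fin n → ℕ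
colAbove {n} M i = sum (tabulate λ (j : Fin n) → if toℕ j <ᵇ toℕ i then entry M j i else 0)

rowRight : ∀ {n} → Matrix n → Fin n → ℕ
rowRight {n} M i = sum (tabulate λ (j : Fin n) → if toℕ i <ᵇ toℕ j then entry M i j else 0)

-- Tesler matrix associated to a: upper triangular, nonnegative integer entries, and
-- m_ii + Σ_{j<i} m_ji - Σ_{j>i} m_ij = a_i  (written without truncated subtraction)
IsTesler : ∀ {n} → Vec ℕ n → Matrix n → Set
IsTesler {n} a M =
  UpperTriangular M ×
  ((i : Fin n) → entry M i i + colAbove M i ≡ lookup a i + rowRight M i)

TwoDiagonal : ∀ {n} → Matrix n → Set
TwoDiagonal {n} M = (i j : Fin n) → 1 + toℕ i < toℕ j → entry M i j ≡ 0

TwoDiagTesler : ∀ {n} → Vec ℕ n → Set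
TwoDiagTesler {n} a = Σ (Matrix n) (λ M → IsTesler a M × TwoDiagonal M)

suffixSums : ∀ {k} → Vec ℕ k → List ℕ
suffixSums [] = []
suffixSums (x ∷ xs) = (x + sum xs) ∷ suffixSums xs

lambdaOfTail : ∀ {n} → Vec ℕ n → List ℕ
lambdaOfTail [] = []
lambdaOfTail (_ ∷ xs) = suffixSums xs

IsPartition : List ℕ → Set
IsPartition μ = Linked _≥_ μ × All (λ x → 0 < x) μ

_⊆ₚ_ : List ℕ → List ℕ → Set
[] ⊆ₚ _ = ⊤
(x ∷ xs) ⊆ₚ [] = x ≤ 0 × (xs ⊆ₚ [])
(x ∷ xs) ⊆ₚ (y ∷ ys) = x ≤ y × (xs ⊆ₚ ys)

PartitionsIn : List ℕ → Set
PartitionsIn λ′ = Σ (List ℕ) (λ μ → IsPartition μ × (μ ⊆ₚ λ′))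

-- The sets, as setoids: two elements are equal iff the underlying matrices / partitions are equal
-- (the proof components are propositions; this avoids needing function extensionality).
TwoDiagTeslerSet : ∀ {n} → Vec ℕ n → Setoid _ _
TwoDiagTeslerSet {n} a = On.setoid {B = TwoDiagTesler a} (setoid (Matrix n)) proj₁

PartitionsInSet : List ℕ → Setoid _ _
PartitionsInSet λ′ = On.setoid {B = PartitionsIn λ′} (setoid (List ℕ)) proj₁

module Submission where

open import Defs
open import Data.Nat using (ℕ)
open import Data.Vec using (Vec)
open import Function.Bundles using (Bijection)

open import Data.Nat using (zero; suc; _+_; _∸_; _≤_; _<_; _≥_; z≤n; s≤s; _<ᵇ_; _<?_)
open import Data.Nat.Properties
open import Data.Bool using (if_then_else_)
open import Data.Fin as Fin using (Fin; toℕ; fromℕ<)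
open import Data.Fin.Properties using (toℕ<n; toℕ-fromℕ<)
open import Data.Vec using ([]; _∷_; lookup; tabulate; sum)
open import Data.Vec.Properties using (lookup∘tabulate)
open import Data.List using (List; []; _∷_; length)
open import Data.List.Relation.Unary.All using (All; []; _∷_)
open import Data.List.Relation.Unary.Linked using (Linked; []; [-]; _∷_)
open import Data.Product using (_,_; proj₁)
open import Data.Sum using (inj₁; inj₂)
open import Data.Unit using (tt)
open import Data.Empty using (⊥-elim)
open import Relation.Nullary using (yes; no; ¬_)
open import Relation.Binary using (Tri; tri<; tri≈; tri>)
open import Relation.Binary.PropositionalEquality

-- Index from 0.  A two-diagonal Tesler matrix is determined by its superdiagonal
-- e_k = m_{k,k+1}: the defining equations force the diagonal d_k = a_k + e_k − e_{k−1}
-- (with e_{−1} = e_{n−1} = 0), and d_{k+1} ≥ 0 says e_k ≤ a_{k+1} + e_{k+1}.  Iterating from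
-- e_{n−1} = 0 gives e_k ≤ Λ_k = a_{k+1} + ⋯ + a_{n−1}, the k-th part of λ(a₁, …, a_{n−1}),
-- and under μ_k = Λ_k − e_k the same inequality reads μ_{k+1} ≤ μ_k.  So e ↦ Λ − e is a
-- bijection onto the partitions μ ⊆ λ.

-- Vectors, matrices and lists are read at natural-number positions with value 0 outside
-- their range, so that the bidiagonal shape is described by index arithmetic alone.

vecAt : ∀ {n} → Vec ℕ n → ℕ → ℕ
vecAt [] _ = 0
vecAt (x ∷ xs) zero = x
vecAt (x ∷ xs) (suc k) = vecAt xs k

vecAt-lookup : ∀ {n} (v : Vec ℕ n) (i : Fin n) → vecAt v (toℕ i) ≡ lookup v i
vecAt-lookup (x ∷ xs) Fin.zero = refl
vecAt-lookup (x ∷ xs) (Fin.suc i) = vecAt-lookup xs i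

vecAt-≥ : ∀ {n} (v : Vec ℕ n) {k} → n ≤ k → vecAt v k ≡ 0
vecAt-≥ [] _ = refl
vecAt-≥ (x ∷ xs) (s≤s n≤k) = vecAt-≥ xs n≤k

vecAt-injective : ∀ {n} (v w : Vec ℕ n) → (∀ k → vecAt v k ≡ vecAt w k) → v ≡ w
vecAt-injective [] [] _ = refl
vecAt-injective (x ∷ xs) (y ∷ ys) eq =
  cong₂ _∷_ (eq 0) (vecAt-injective xs ys (λ k → eq (suc k)))

matAt : ∀ {m n} → Vec (Vec ℕ n) m → ℕ → ℕ → ℕ
matAt [] _ _ = 0
matAt (r ∷ rs) zero j = vecAt r j
matAt (r ∷ rs) (suc i) j = matAt rs i j

matAt-lookup : ∀ {m n} (M : Vec (Vec ℕ n) m) (i : Fin m) (j : Fin n) →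
               matAt M (toℕ i) (toℕ j) ≡ lookup (lookup M i) j
matAt-lookup (r ∷ rs) Fin.zero j = vecAt-lookup r j
matAt-lookup (r ∷ rs) (Fin.suc i) j = matAt-lookup rs i j

matAt-row≥ : ∀ {m n} (M : Vec (Vec ℕ n) m) {i} j → m ≤ i → matAt M i j ≡ 0
matAt-row≥ [] j _ = refl
matAt-row≥ (r ∷ rs) j (s≤s m≤i) = matAt-row≥ rs j m≤i

matAt-col≥ : ∀ {m n} (M : Vec (Vec ℕ n) m) i {j} → n ≤ j → matAt M i j ≡ 0
matAt-col≥ [] i _ = refl
matAt-col≥ (r ∷ rs) zero n≤j = vecAt-≥ r n≤j
matAt-col≥ (r ∷ rs) (suc i) n≤j = matAt-col≥ rs i n≤j

matAt-injective : ∀ {m n} (M N : Vec (Vec ℕ n) m) →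
                  (∀ i j → matAt M i j ≡ matAt N i j) → M ≡ N
matAt-injective [] [] _ = refl
matAt-injective (r ∷ rs) (s ∷ ss) eq =
  cong₂ _∷_ (vecAt-injective r s (eq 0)) (matAt-injective rs ss (λ i → eq (suc i)))

matAt-fromℕ< : ∀ {n} (M : Matrix n) {i j} (i<n : i < n) (j<n : j < n) →
               matAt M i j ≡ entry M (fromℕ< i<n) (fromℕ< j<n)
matAt-fromℕ< M i<n j<n =
  subst₂ (λ i j → matAt M i j ≡ entry M (fromℕ< i<n) (fromℕ< j<n))
    (toℕ-fromℕ< i<n) (toℕ-fromℕ< j<n) (matAt-lookup M (fromℕ< i<n) (fromℕ< j<n))

matOf : ∀ {n} → (ℕ → ℕ → ℕ) → Matrix n
matOf g = tabulate λ i → tabulate λ j → g (toℕ i) (toℕ j)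

matAt-matOf : ∀ {n} (g : ℕ → ℕ → ℕ) {i j} (i<n : i < n) (j<n : j < n) →
              matAt (matOf {n} g) i j ≡ g i j
matAt-matOf {n} g {i} {j} i<n j<n = begin
  matAt (matOf {n} g) i j
    ≡⟨ matAt-fromℕ< (matOf g) i<n j<n ⟩
  lookup (lookup (matOf {n} g) (fromℕ< i<n)) (fromℕ< j<n)
    ≡⟨ cong (λ r → lookup r (fromℕ< j<n)) (lookup∘tabulate _ (fromℕ< i<n)) ⟩
  lookup (tabulate λ j′ → g (toℕ (fromℕ< i<n)) (toℕ j′)) (fromℕ< j<n)
    ≡⟨ lookup∘tabulate _ (fromℕ< j<n) ⟩
  g (toℕ (fromℕ< i<n)) (toℕ (fromℕ< j<n))
    ≡⟨ cong₂ g (toℕ-fromℕ< i<n) (toℕ-fromℕ< j<n) ⟩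
  g i j ∎
  where open ≡-Reasoning

matAt-matOf-≡0 : ∀ {n} (g : ℕ → ℕ → ℕ) i j → g i j ≡ 0 →
                 matAt (matOf {n} g) i j ≡ 0
matAt-matOf-≡0 {n} g i j gij≡0 with i <? n | j <? n
... | yes i<n | yes j<n = trans (matAt-matOf g i<n j<n) gij≡0
... | no i≮n | _ = matAt-row≥ (matOf g) j (≮⇒≥ i≮n)
... | yes _ | no j≮n = matAt-col≥ (matOf g) i (≮⇒≥ j≮n)

bidiagonal : (ℕ → ℕ) → (ℕ → ℕ) → ℕ → ℕ → ℕ
bidiagonal d e zero zero = d 0
bidiagonal d e zero (suc zero) = e 0
bidiagonal d e zero (suc (suc _)) = 0
bidiagonal d e (suc i) zero = 0
bidiagonal d e (suc i) (suc j) = bidiagonal (λ k → d (suc k)) (λ k → e (suc k)) i j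

bidiagonal-diag : ∀ d e i → bidiagonal d e i i ≡ d i
bidiagonal-diag d e zero = refl
bidiagonal-diag d e (suc i) = bidiagonal-diag _ _ i

bidiagonal-super : ∀ d e i → bidiagonal d e i (suc i) ≡ e i
bidiagonal-super d e zero = refl
bidiagonal-super d e (suc i) = bidiagonal-super _ _ i

bidiagonal-below : ∀ d e i j → j < i → bidiagonal d e i j ≡ 0
bidiagonal-below d e (suc i) zero _ = refl
bidiagonal-below d e (suc i) (suc j) (s≤s j<i) = bidiagonal-below _ _ i j j<i

bidiagonal-far : ∀ d e i j → suc i < j → bidiagonal d e i j ≡ 0
bidiagonal-far d e zero (suc zero) (s≤s ())
bidiagonal-far d e zero (suc (suc j)) _ = refl
bidiagonal-far d e (suc i) (suc j) (s≤s i+1<j) = bidiagonal-far _ _ i j i+1<j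

sumBelow : (ℕ → ℕ) → ℕ → ℕ
sumBelow h zero = 0
sumBelow h (suc n) = h 0 + sumBelow (λ j → h (suc j)) n

sum-tabulate : ∀ {n} (f : Fin n → ℕ) (h : ℕ → ℕ) → (∀ j → f j ≡ h (toℕ j)) →
               sum (tabulate f) ≡ sumBelow h n
sum-tabulate {zero} f h eq = refl
sum-tabulate {suc n} f h eq =
  cong₂ _+_ (eq Fin.zero)
    (sum-tabulate (λ j → f (Fin.suc j)) (λ j → h (suc j)) (λ j → eq (Fin.suc j)))

sumBelow-≡0 : ∀ h n → (∀ j → h j ≡ 0) → sumBelow h n ≡ 0
sumBelow-≡0 h zero _ = refl
sumBelow-≡0 h (suc n) h≡0 = cong₂ _+_ (h≡0 0) (sumBelow-≡0 _ n (λ j → h≡0 (suc j)))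

sumBelow-single : ∀ h n k → (∀ j → ¬ j ≡ k → h j ≡ 0) → (n ≤ k → h k ≡ 0) →
                  sumBelow h n ≡ h k
sumBelow-single h zero k _ outside = sym (outside z≤n)
sumBelow-single h (suc n) zero others _ =
  trans (cong (h 0 +_) (sumBelow-≡0 _ n (λ j → others (suc j) λ ()))) (+-identityʳ _)
sumBelow-single h (suc n) (suc k) others outside =
  trans (cong (_+ sumBelow (λ j → h (suc j)) n) (others 0 λ ()))
    (sumBelow-single (λ j → h (suc j)) n k
      (λ j j≢k → others (suc j) (λ eq → j≢k (suc-injective eq)))
      (λ n≤k → outside (s≤s n≤k)))

if-<ᵇ-< : ∀ {j i} x → j < i → (if j <ᵇ i then x else 0) ≡ x
if-<ᵇ-< {zero} {suc i} x _ = refl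
if-<ᵇ-< {suc j} {suc i} x (s≤s j<i) = if-<ᵇ-< {j} {i} x j<i

if-<ᵇ-≥ : ∀ {j i} x → i ≤ j → (if j <ᵇ i then x else 0) ≡ 0
if-<ᵇ-≥ {zero} {zero} x _ = refl
if-<ᵇ-≥ {suc j} {zero} x _ = refl
if-<ᵇ-≥ {suc j} {suc i} x (s≤s i≤j) = if-<ᵇ-≥ {j} {i} x i≤j

prev : (ℕ → ℕ) → ℕ → ℕ
prev e zero = 0
prev e (suc k) = e k

prev-cong : ∀ {e f} → (∀ k → e k ≡ f k) → ∀ k → prev e k ≡ prev f k
prev-cong e≡f zero = refl
prev-cong e≡f (suc k) = e≡f k

super : ∀ {n} → Matrix n → ℕ → ℕ
super M k = matAt M k (suc k)

UpperTriangularℕ : ∀ {n} → Matrix n → Set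
UpperTriangularℕ M = ∀ i j → j < i → matAt M i j ≡ 0

TwoDiagonalℕ : ∀ {n} → Matrix n → Set
TwoDiagonalℕ M = ∀ i j → suc i < j → matAt M i j ≡ 0

upperTriangularℕ : ∀ {n} (M : Matrix n) → UpperTriangular M → UpperTriangularℕ M
upperTriangularℕ {n} M ut i j j<i with i <? n
... | no i≮n = matAt-row≥ M j (≮⇒≥ i≮n)
... | yes i<n = trans (matAt-fromℕ< M i<n j<n)
                  (ut _ _ (subst₂ _<_ (sym (toℕ-fromℕ< j<n)) (sym (toℕ-fromℕ< i<n)) j<i))
  where j<n = <-trans j<i i<n

twoDiagonalℕ : ∀ {n} (M : Matrix n) → TwoDiagonal M → TwoDiagonalℕ M
twoDiagonalℕ {n} M td i j i+1<j with j <? n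
... | no j≮n = matAt-col≥ M i (≮⇒≥ j≮n)
... | yes j<n = trans (matAt-fromℕ< M i<n j<n)
                  (td _ _ (subst₂ (λ i j → suc i < j)
                             (sym (toℕ-fromℕ< i<n)) (sym (toℕ-fromℕ< j<n)) i+1<j))
  where i<n = <-trans (<-trans (n<1+n i) i+1<j) j<n

columnSum-twoDiagonal : ∀ {n} (M : Matrix n) → TwoDiagonalℕ M → ∀ i → i < n →
                        sumBelow (λ j → if j <ᵇ i then matAt M j i else 0) n ≡ prev (super M) i
columnSum-twoDiagonal {n} M td zero _ =
  sumBelow-≡0 _ n (λ j → if-<ᵇ-≥ {j} (matAt M j 0) z≤n)
columnSum-twoDiagonal {n} M td (suc k) k<n =
  trans (sumBelow-single _ n k others
           (λ n≤k → ⊥-elim (<-irrefl refl (≤-trans k<n (m≤n⇒m≤1+n n≤k)))))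
        (if-<ᵇ-< (super M k) (n<1+n k))
  where
  others : ∀ j → ¬ j ≡ k → (if j <ᵇ suc k then matAt M j (suc k) else 0) ≡ 0
  others j j≢k with <-cmp j k
  ... | tri< j<k _ _ = trans (if-<ᵇ-< _ (m≤n⇒m≤1+n j<k)) (td j (suc k) (s≤s j<k))
  ... | tri≈ _ j≡k _ = ⊥-elim (j≢k j≡k)
  ... | tri> _ _ k<j = if-<ᵇ-≥ _ k<j

rowSum-twoDiagonal : ∀ {n} (M : Matrix n) → TwoDiagonalℕ M → ∀ i →
                     sumBelow (λ j → if i <ᵇ j then matAt M i j else 0) n ≡ super M i
rowSum-twoDiagonal {n} M td i =
  trans (sumBelow-single _ n (suc i) others
           (λ n≤i+1 → trans (if-<ᵇ-< _ (n<1+n i)) (matAt-col≥ M i n≤i+1)))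
        (if-<ᵇ-< (super M i) (n<1+n i))
  where
  others : ∀ j → ¬ j ≡ suc i → (if i <ᵇ j then matAt M i j else 0) ≡ 0
  others j j≢i+1 with <-cmp i j
  ... | tri≈ _ i≡j _ = if-<ᵇ-≥ _ (≤-reflexive (sym i≡j))
  ... | tri> _ _ j<i = if-<ᵇ-≥ _ (<⇒≤ j<i)
  ... | tri< i<j _ _ with m≤n⇒m<n∨m≡n i<j
  ...   | inj₁ i+1<j = trans (if-<ᵇ-< _ i<j) (td i j i+1<j)
  ...   | inj₂ i+1≡j = ⊥-elim (j≢i+1 (sym i+1≡j))

colAbove-twoDiagonal : ∀ {n} (M : Matrix n) → TwoDiagonalℕ M → (i : Fin n) →
                       colAbove M i ≡ prev (super M) (toℕ i)
colAbove-twoDiagonal M td i =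
  trans (sum-tabulate _ _ λ j →
           cong (λ x → if toℕ j <ᵇ toℕ i then x else 0) (sym (matAt-lookup M j i)))
        (columnSum-twoDiagonal M td (toℕ i) (toℕ<n i))

rowRight-twoDiagonal : ∀ {n} (M : Matrix n) → TwoDiagonalℕ M → (i : Fin n) →
                       rowRight M i ≡ super M (toℕ i)
rowRight-twoDiagonal M td i =
  trans (sum-tabulate _ _ λ j →
           cong (λ x → if toℕ i <ᵇ toℕ j then x else 0) (sym (matAt-lookup M i j)))
        (rowSum-twoDiagonal M td (toℕ i))

nth : List ℕ → ℕ → ℕ
nth [] _ = 0
nth (x ∷ xs) zero = x
nth (x ∷ xs) (suc k) = nth xs k

suffixFrom : ∀ {n} → Vec ℕ n → ℕ → ℕ
suffixFrom [] _ = 0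
suffixFrom (x ∷ xs) zero = x + sum xs
suffixFrom (x ∷ xs) (suc k) = suffixFrom xs k

suffixFrom-zero : ∀ {n} (v : Vec ℕ n) → suffixFrom v 0 ≡ sum v
suffixFrom-zero [] = refl
suffixFrom-zero (x ∷ xs) = refl

suffixFrom-step : ∀ {n} (v : Vec ℕ n) k → suffixFrom v k ≡ vecAt v k + suffixFrom v (suc k)
suffixFrom-step [] k = refl
suffixFrom-step (x ∷ xs) zero = cong (x +_) (sym (suffixFrom-zero xs))
suffixFrom-step (x ∷ xs) (suc k) = suffixFrom-step xs k

suffixFrom-≥ : ∀ {n} (v : Vec ℕ n) {k} → n ≤ k → suffixFrom v k ≡ 0
suffixFrom-≥ [] _ = refl
suffixFrom-≥ (x ∷ xs) (s≤s n≤k) = suffixFrom-≥ xs n≤k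

nth-suffixSums : ∀ {n} (v : Vec ℕ n) k → nth (suffixSums v) k ≡ suffixFrom v k
nth-suffixSums [] k = refl
nth-suffixSums (x ∷ xs) zero = refl
nth-suffixSums (x ∷ xs) (suc k) = nth-suffixSums xs k

nth-lambdaOfTail : ∀ {n} (v : Vec ℕ n) k → nth (lambdaOfTail v) k ≡ suffixFrom v (suc k)
nth-lambdaOfTail [] k = refl
nth-lambdaOfTail (x ∷ xs) k = nth-suffixSums xs k

length-suffixSums : ∀ {n} (v : Vec ℕ n) → length (suffixSums v) ≡ n
length-suffixSums [] = refl
length-suffixSums (x ∷ xs) = cong suc (length-suffixSums xs)

length-lambdaOfTail : ∀ {n} (v : Vec ℕ n) → length (lambdaOfTail v) ≤ n
length-lambdaOfTail [] = z≤n
length-lambdaOfTail (x ∷ xs) = ≤-trans (≤-reflexive (length-suffixSums xs)) (n≤1+n _)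

⊆ₚ⇒nth≤ : ∀ μ ν → μ ⊆ₚ ν → ∀ k → nth μ k ≤ nth ν k
⊆ₚ⇒nth≤ [] ν _ k = z≤n
⊆ₚ⇒nth≤ (x ∷ xs) [] (x≤0 , _) zero = x≤0
⊆ₚ⇒nth≤ (x ∷ xs) [] (_ , xs⊆) (suc k) = ⊆ₚ⇒nth≤ xs [] xs⊆ k
⊆ₚ⇒nth≤ (x ∷ xs) (y ∷ ys) (x≤y , _) zero = x≤y
⊆ₚ⇒nth≤ (x ∷ xs) (y ∷ ys) (_ , xs⊆ys) (suc k) = ⊆ₚ⇒nth≤ xs ys xs⊆ys k

nth≤⇒⊆ₚ : ∀ μ ν → (∀ k → nth μ k ≤ nth ν k) → μ ⊆ₚ ν
nth≤⇒⊆ₚ [] ν _ = tt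
nth≤⇒⊆ₚ (x ∷ xs) [] le = le 0 , nth≤⇒⊆ₚ xs [] (λ k → le (suc k))
nth≤⇒⊆ₚ (x ∷ xs) (y ∷ ys) le = le 0 , nth≤⇒⊆ₚ xs ys (λ k → le (suc k))

⊆ₚ⇒length≤ : ∀ μ ν → All (0 <_) μ → μ ⊆ₚ ν → length μ ≤ length ν
⊆ₚ⇒length≤ [] ν _ _ = z≤n
⊆ₚ⇒length≤ (x ∷ xs) [] (0<x ∷ _) (x≤0 , _) = ⊥-elim (<-irrefl refl (≤-trans 0<x x≤0))
⊆ₚ⇒length≤ (x ∷ xs) (y ∷ ys) (_ ∷ pos) (_ , xs⊆ys) = s≤s (⊆ₚ⇒length≤ xs ys pos xs⊆ys)

Antitone : (ℕ → ℕ) → Set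
Antitone m = ∀ k → m (suc k) ≤ m k

Linked⇒antitone : ∀ μ → Linked _≥_ μ → Antitone (nth μ)
Linked⇒antitone [] [] k = z≤n
Linked⇒antitone (x ∷ []) [-] k = z≤n
Linked⇒antitone (x ∷ y ∷ ys) (y≤x ∷ _) zero = y≤x
Linked⇒antitone (x ∷ y ∷ ys) (_ ∷ linked) (suc k) = Linked⇒antitone (y ∷ ys) linked k

antitone⇒Linked : ∀ μ → Antitone (nth μ) → Linked _≥_ μ
antitone⇒Linked [] _ = []
antitone⇒Linked (x ∷ []) _ = [-]
antitone⇒Linked (x ∷ y ∷ ys) anti = anti 0 ∷ antitone⇒Linked (y ∷ ys) (λ k → anti (suc k))

antitone-≤-zero : ∀ m → Antitone m → ∀ k → m k ≤ m 0
antitone-≤-zero m anti zero = ≤-refl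
antitone-≤-zero m anti (suc k) = ≤-trans (anti k) (antitone-≤-zero m anti k)

partitionOf : (ℕ → ℕ) → ℕ → List ℕ
partitionOf m zero = []
partitionOf m (suc N) with m 0
... | zero = []
... | suc x = suc x ∷ partitionOf (λ k → m (suc k)) N

partitionOf-positive : ∀ m N → All (0 <_) (partitionOf m N)
partitionOf-positive m zero = []
partitionOf-positive m (suc N) with m 0
... | zero = []
... | suc x = s≤s z≤n ∷ partitionOf-positive _ N

nth-partitionOf : ∀ m N → Antitone m → (∀ k → N ≤ k → m k ≡ 0) →
                  ∀ k → nth (partitionOf m N) k ≡ m k
nth-partitionOf m zero _ vanish k = sym (vanish k z≤n)
nth-partitionOf m (suc N) anti vanish k with m 0 in m0≡
... | zero = sym (n≤0⇒n≡0 (subst (m k ≤_) m0≡ (antitone-≤-zero m anti k)))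
nth-partitionOf m (suc N) anti vanish zero | suc x = sym m0≡
nth-partitionOf m (suc N) anti vanish (suc k) | suc x =
  nth-partitionOf (λ k → m (suc k)) N (λ k → anti (suc k))
    (λ k N≤k → vanish (suc k) (s≤s N≤k)) k

partitionOf-nth : ∀ m N μ → All (0 <_) μ → length μ ≤ N → (∀ k → m k ≡ nth μ k) →
                  partitionOf m N ≡ μ
partitionOf-nth m zero [] _ _ _ = refl
partitionOf-nth m (suc N) [] _ _ m≡ rewrite m≡ 0 = refl
partitionOf-nth m (suc N) (suc x ∷ xs) (_ ∷ pos) (s≤s len≤) m≡ rewrite m≡ 0 =
  cong (suc x ∷_) (partitionOf-nth _ N xs pos len≤ (λ k → m≡ (suc k)))

module Correspondence {n : ℕ} (a : Vec ℕ n) where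

  Λ : ℕ → ℕ
  Λ k = suffixFrom a (suc k)

  Λ-step : ∀ k → Λ k ≡ vecAt a (suc k) + Λ (suc k)
  Λ-step k = suffixFrom-step a (suc k)

  Λ-≥ : ∀ {k} → n ≤ suc k → Λ k ≡ 0
  Λ-≥ = suffixFrom-≥ a

  -- e_k ≤ a_{k+1} + e_{k+1} says that the diagonal entry d_{k+1} forced by e is nonnegative.
  NonnegDiagonal : (ℕ → ℕ) → Set
  NonnegDiagonal e = ∀ k → e k ≤ vecAt a (suc k) + e (suc k)

  Vanishing : (ℕ → ℕ) → Set
  Vanishing e = ∀ k → n ≤ suc k → e k ≡ 0

  nonnegDiagonal⇒≤Λ : ∀ e → NonnegDiagonal e → Vanishing e → ∀ k → e k ≤ Λ k
  nonnegDiagonal⇒≤Λ e step vanish k = bounded n k (m≤m+n n k)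
    where
    open ≤-Reasoning
    bounded : ∀ d k → n ≤ d + k → e k ≤ Λ k
    bounded zero k n≤k = subst (_≤ Λ k) (sym (vanish k (m≤n⇒m≤1+n n≤k))) z≤n
    bounded (suc d) k n≤d+1+k = begin
      e k                         ≤⟨ step k ⟩
      vecAt a (suc k) + e (suc k) ≤⟨ +-monoʳ-≤ (vecAt a (suc k)) (bounded d (suc k) n≤d+[1+k]) ⟩
      vecAt a (suc k) + Λ (suc k) ≡⟨ sym (Λ-step k) ⟩
      Λ k                         ∎
      where n≤d+[1+k] = subst (n ≤_) (sym (+-suc d k)) n≤d+1+k

  Λ∸-antitone : ∀ e → NonnegDiagonal e → Antitone (λ k → Λ k ∸ e k)
  Λ∸-antitone e step k = begin
    Λ (suc k) ∸ e (suc k)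
      ≡⟨ sym ([m+n]∸[m+o]≡n∸o (vecAt a (suc k)) (Λ (suc k)) (e (suc k))) ⟩
    vecAt a (suc k) + Λ (suc k) ∸ (vecAt a (suc k) + e (suc k))
      ≤⟨ ∸-monoʳ-≤ (vecAt a (suc k) + Λ (suc k)) (step k) ⟩
    vecAt a (suc k) + Λ (suc k) ∸ e k
      ≡⟨ cong (_∸ e k) (sym (Λ-step k)) ⟩
    Λ k ∸ e k ∎
    where open ≤-Reasoning

  Λ∸-nonnegDiagonal : ∀ μ → Antitone μ → (∀ k → μ k ≤ Λ k) →
                      NonnegDiagonal (λ k → Λ k ∸ μ k)
  Λ∸-nonnegDiagonal μ anti μ≤Λ k = begin
    Λ k ∸ μ k
      ≡⟨ cong (_∸ μ k) (Λ-step k) ⟩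
    vecAt a (suc k) + Λ (suc k) ∸ μ k
      ≤⟨ ∸-monoʳ-≤ (vecAt a (suc k) + Λ (suc k)) (anti k) ⟩
    vecAt a (suc k) + Λ (suc k) ∸ μ (suc k)
      ≡⟨ +-∸-assoc (vecAt a (suc k)) (μ≤Λ (suc k)) ⟩
    vecAt a (suc k) + (Λ (suc k) ∸ μ (suc k)) ∎
    where open ≤-Reasoning

  Λ∸-vanishing : (μ : ℕ → ℕ) → Vanishing (λ k → Λ k ∸ μ k)
  Λ∸-vanishing μ k n≤k+1 = trans (cong (_∸ μ k) (Λ-≥ n≤k+1)) (0∸n≡0 (μ k))

  Teslerℕ : Matrix n → Set
  Teslerℕ M = ∀ k → k < n → matAt M k k + prev (super M) k ≡ vecAt a k + super M k

  module _ (M : Matrix n) (td : TwoDiagonalℕ M) where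

    tesler⇒TeslerℕAt : (i : Fin n) →
               entry M i i + colAbove M i ≡ lookup a i + rowRight M i →
               matAt M (toℕ i) (toℕ i) + prev (super M) (toℕ i) ≡ vecAt a (toℕ i) + super M (toℕ i)
    tesler⇒TeslerℕAt i tesler =
      trans (cong₂ _+_ (matAt-lookup M i i) (sym (colAbove-twoDiagonal M td i)))
        (trans tesler (cong₂ _+_ (sym (vecAt-lookup a i)) (rowRight-twoDiagonal M td i)))

    tesler⇒Teslerℕ : (∀ i → entry M i i + colAbove M i ≡ lookup a i + rowRight M i) → Teslerℕ M
    tesler⇒Teslerℕ tesler k k<n =
      subst (λ k → matAt M k k + prev (super M) k ≡ vecAt a k + super M k)
        (toℕ-fromℕ< k<n) (tesler⇒TeslerℕAt (fromℕ< k<n) (tesler (fromℕ< k<n)))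

    Teslerℕ⇒tesler : Teslerℕ M → ∀ i → entry M i i + colAbove M i ≡ lookup a i + rowRight M i
    Teslerℕ⇒tesler tesler i =
      trans (cong₂ _+_ (sym (matAt-lookup M i i)) (colAbove-twoDiagonal M td i))
        (trans (tesler (toℕ i) (toℕ<n i))
          (cong₂ _+_ (vecAt-lookup a i) (sym (rowRight-twoDiagonal M td i))))

  super-nonnegDiagonal : ∀ M → Teslerℕ M → NonnegDiagonal (super M)
  super-nonnegDiagonal M tesler k with suc k <? n
  ... | yes k+1<n = ≤-trans (m≤n+m (super M k) _) (≤-reflexive (tesler (suc k) k+1<n))
  ... | no k+1≮n =
    subst (_≤ vecAt a (suc k) + super M (suc k)) (sym (matAt-col≥ M k (≮⇒≥ k+1≮n))) z≤n

  super-vanishing : ∀ M → Vanishing (super M)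
  super-vanishing M k = matAt-col≥ M k

  diagonalOf : (ℕ → ℕ) → ℕ → ℕ
  diagonalOf e k = vecAt a k + e k ∸ prev e k

  bandOf : (ℕ → ℕ) → ℕ → ℕ → ℕ
  bandOf e = bidiagonal (diagonalOf e) e

  fromSuper : (ℕ → ℕ) → Matrix n
  fromSuper e = matOf (bandOf e)

  matAt-fromSuper : ∀ e {i j} → i < n → j < n → matAt (fromSuper e) i j ≡ bandOf e i j
  matAt-fromSuper e = matAt-matOf {n} (bandOf e)

  fromSuper-≡0 : ∀ e i j → bandOf e i j ≡ 0 → matAt (fromSuper e) i j ≡ 0
  fromSuper-≡0 e = matAt-matOf-≡0 {n} (bandOf e)

  super-fromSuper : ∀ e → Vanishing e → ∀ k → super (fromSuper e) k ≡ e k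
  super-fromSuper e vanish k with suc k <? n
  ... | yes k+1<n =
    trans (matAt-fromSuper e (<-trans (n<1+n k) k+1<n) k+1<n) (bidiagonal-super (diagonalOf e) e k)
  ... | no k+1≮n =
    trans (matAt-col≥ (fromSuper e) k (≮⇒≥ k+1≮n)) (sym (vanish k (≮⇒≥ k+1≮n)))

  fromSuper-upperTriangular : ∀ e → UpperTriangularℕ (fromSuper e)
  fromSuper-upperTriangular e i j j<i = fromSuper-≡0 e i j (bidiagonal-below (diagonalOf e) e i j j<i)

  fromSuper-twoDiagonal : ∀ e → TwoDiagonalℕ (fromSuper e)
  fromSuper-twoDiagonal e i j i+1<j = fromSuper-≡0 e i j (bidiagonal-far (diagonalOf e) e i j i+1<j)

  fromSuper-tesler : ∀ e → NonnegDiagonal e → Vanishing e → Teslerℕ (fromSuper e)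
  fromSuper-tesler e step vanish k k<n = begin
    matAt (fromSuper e) k k + prev (super (fromSuper e)) k
      ≡⟨ cong₂ _+_ (trans (matAt-fromSuper e k<n k<n) (bidiagonal-diag (diagonalOf e) e k))
                   (prev-cong (super-fromSuper e vanish) k) ⟩
    vecAt a k + e k ∸ prev e k + prev e k
      ≡⟨ m∸n+n≡m (prev≤ k) ⟩
    vecAt a k + e k
      ≡⟨ cong (vecAt a k +_) (sym (super-fromSuper e vanish k)) ⟩
    vecAt a k + super (fromSuper e) k ∎
    where
    open ≡-Reasoning
    prev≤ : ∀ k → prev e k ≤ vecAt a k + e k
    prev≤ zero = z≤n
    prev≤ (suc k) = step k

  fromSuper-super : ∀ M e → UpperTriangularℕ M → TwoDiagonalℕ M → Teslerℕ M →
                    (∀ k → e k ≡ super M k) → fromSuper e ≡ M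
  fromSuper-super M e ut td tesler e≡ = matAt-injective _ _ entrywise
    where
    open ≡-Reasoning
    onBand : ∀ i j → i < n → Tri (j < i) (j ≡ i) (i < j) → bandOf e i j ≡ matAt M i j
    onBand i j _ (tri< j<i _ _) = trans (bidiagonal-below (diagonalOf e) e i j j<i) (sym (ut i j j<i))
    onBand i .i i<n (tri≈ _ refl _) = begin
      bandOf e i i
        ≡⟨ bidiagonal-diag (diagonalOf e) e i ⟩
      vecAt a i + e i ∸ prev e i
        ≡⟨ cong₂ _∸_ (cong (vecAt a i +_) (e≡ i)) (prev-cong e≡ i) ⟩
      vecAt a i + super M i ∸ prev (super M) i
        ≡⟨ cong (_∸ prev (super M) i) (sym (tesler i i<n)) ⟩
      matAt M i i + prev (super M) i ∸ prev (super M) i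
        ≡⟨ m+n∸n≡m (matAt M i i) (prev (super M) i) ⟩
      matAt M i i ∎
    onBand i j _ (tri> _ _ i<j) with m≤n⇒m<n∨m≡n i<j
    ... | inj₁ i+1<j = trans (bidiagonal-far (diagonalOf e) e i j i+1<j) (sym (td i j i+1<j))
    ... | inj₂ refl = trans (bidiagonal-super (diagonalOf e) e i) (e≡ i)
    entrywise : ∀ i j → matAt (fromSuper e) i j ≡ matAt M i j
    entrywise i j with i <? n | j <? n
    ... | no i≮n | _ =
      trans (matAt-row≥ (fromSuper e) j (≮⇒≥ i≮n)) (sym (matAt-row≥ M j (≮⇒≥ i≮n)))
    ... | yes _ | no j≮n =
      trans (matAt-col≥ (fromSuper e) i (≮⇒≥ j≮n)) (sym (matAt-col≥ M i (≮⇒≥ j≮n)))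
    ... | yes i<n | yes j<n = trans (matAt-fromSuper e i<n j<n) (onBand i j i<n (<-cmp j i))

  toPartition : Matrix n → List ℕ
  toPartition M = partitionOf (λ k → Λ k ∸ super M k) n

  fromPartition : List ℕ → Matrix n
  fromPartition μ = fromSuper (λ k → Λ k ∸ nth μ k)

  nth-toPartition : ∀ M → NonnegDiagonal (super M) →
                    ∀ k → nth (toPartition M) k ≡ Λ k ∸ super M k
  nth-toPartition M step = nth-partitionOf _ n (Λ∸-antitone (super M) step)
    (λ k n≤k → Λ∸-vanishing (super M) k (m≤n⇒m≤1+n n≤k))

  ⊆λ⇒≤Λ : ∀ {μ} → μ ⊆ₚ lambdaOfTail a → ∀ k → nth μ k ≤ Λ k
  ⊆λ⇒≤Λ {μ} μ⊆λ k = subst (nth μ k ≤_) (nth-lambdaOfTail a k) (⊆ₚ⇒nth≤ μ _ μ⊆λ k)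

  teslerℕ : (x : TwoDiagTesler a) → Teslerℕ (proj₁ x)
  teslerℕ (M , (_ , tesler) , td) = tesler⇒Teslerℕ M (twoDiagonalℕ M td) tesler

  partitionOfTesler : TwoDiagTesler a → PartitionsIn (lambdaOfTail a)
  partitionOfTesler x@(M , _) =
    toPartition M , (antitone⇒Linked _ antitone , partitionOf-positive _ n) , nth≤⇒⊆ₚ _ _ ≤λ
    where
    step : NonnegDiagonal (super M)
    step = super-nonnegDiagonal M (teslerℕ x)
    antitone : Antitone (nth (toPartition M))
    antitone k = subst₂ _≤_ (sym (nth-toPartition M step (suc k))) (sym (nth-toPartition M step k))
                   (Λ∸-antitone (super M) step k)
    ≤λ : ∀ k → nth (toPartition M) k ≤ nth (lambdaOfTail a) k
    ≤λ k = subst₂ _≤_ (sym (nth-toPartition M step k)) (sym (nth-lambdaOfTail a k))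
             (m∸n≤m (Λ k) (super M k))

  teslerOfPartition : PartitionsIn (lambdaOfTail a) → TwoDiagTesler a
  teslerOfPartition (μ , (linked , _) , μ⊆λ) =
    M , (upperTriangular , Teslerℕ⇒tesler M td tesler) , twoDiagonal
    where
    e : ℕ → ℕ
    e k = Λ k ∸ nth μ k
    M : Matrix n
    M = fromSuper e
    td : TwoDiagonalℕ M
    td = fromSuper-twoDiagonal e
    tesler : Teslerℕ M
    tesler = fromSuper-tesler e
      (Λ∸-nonnegDiagonal (nth μ) (Linked⇒antitone μ linked) (⊆λ⇒≤Λ μ⊆λ)) (Λ∸-vanishing (nth μ))
    upperTriangular : UpperTriangular M
    upperTriangular i j j<i = trans (sym (matAt-lookup M i j)) (fromSuper-upperTriangular e _ _ j<i)
    twoDiagonal : TwoDiagonal M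
    twoDiagonal i j i+1<j = trans (sym (matAt-lookup M i j)) (td _ _ i+1<j)

  fromPartition-toPartition : (x : TwoDiagTesler a) →
                              fromPartition (toPartition (proj₁ x)) ≡ proj₁ x
  fromPartition-toPartition x@(M , (ut , _) , td) =
    fromSuper-super M _ (upperTriangularℕ M ut) (twoDiagonalℕ M td) (teslerℕ x) recovers
    where
    step : NonnegDiagonal (super M)
    step = super-nonnegDiagonal M (teslerℕ x)
    recovers : ∀ k → Λ k ∸ nth (toPartition M) k ≡ super M k
    recovers k = trans (cong (Λ k ∸_) (nth-toPartition M step k))
                   (m∸[m∸n]≡n (nonnegDiagonal⇒≤Λ (super M) step (super-vanishing M) k))

  toPartition-fromPartition : (p : PartitionsIn (lambdaOfTail a)) →
                              toPartition (fromPartition (proj₁ p)) ≡ proj₁ p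
  toPartition-fromPartition (μ , (_ , positive) , μ⊆λ) =
    partitionOf-nth _ n μ positive
      (≤-trans (⊆ₚ⇒length≤ μ _ positive μ⊆λ) (length-lambdaOfTail a)) recovers
    where
    recovers : ∀ k → Λ k ∸ super (fromPartition μ) k ≡ nth μ k
    recovers k = trans (cong (Λ k ∸_) (super-fromSuper _ (Λ∸-vanishing (nth μ)) k))
                   (m∸[m∸n]≡n (⊆λ⇒≤Λ μ⊆λ k))

  toPartition-injective : (x y : TwoDiagTesler a) →
                          toPartition (proj₁ x) ≡ toPartition (proj₁ y) → proj₁ x ≡ proj₁ y
  toPartition-injective x y same = begin
    proj₁ x                             ≡⟨ sym (fromPartition-toPartition x) ⟩
    fromPartition (toPartition (proj₁ x)) ≡⟨ cong fromPartition same ⟩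
    fromPartition (toPartition (proj₁ y)) ≡⟨ fromPartition-toPartition y ⟩
    proj₁ y                             ∎
    where open ≡-Reasoning

lemma2p8 : (n : ℕ) (a : Vec ℕ n) →
    Bijection (TwoDiagTeslerSet a) (PartitionsInSet (lambdaOfTail a))
lemma2p8 n a = record
  { to = partitionOfTesler
  ; cong = cong toPartition
  ; bijective =
      (λ {x} {y} → toPartition-injective x y)
    , (λ p → teslerOfPartition p , λ z≡x → trans (cong toPartition z≡x) (toPartition-fromPartition p))
  }
  where open Correspondence a
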